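{- Let $\mathcal{M}$ be a matroid of rank $r$ on an $n$-element ground set and $M$ an $\mathbb{H}$-matrix representing $\mathcal{M}$. Then there is an $r\times n$ $\mathbb{H}$-representation $M'$ of $\mathcal{M}$, obtained by removing some rows from $M$, such that $\Lambda_{\mathcal{E}}(M)=\Lambda_{\mathcal{E}}(M')$ and $\Lambda^*_{\mathcal{E}}(M)=\Lambda^*_{\mathcal{E}}(M')$. In particular, $\mathrm{Jac}(M)=\mathrm{Jac}(M')$.
   Context: $\omega=e^{2\pi i/6}$, $\mathcal{E}=\mathbb{Z}[\omega]$, $\mathbb{H}=\{z\in\mathbb{C}:z^6=1\}\cup\{0\}$. An $\mathbb{H}$-matrix is a complex matrix all of whose square subdeterminants lie in $\mathbb{H}$; it represents $\mathcal{M}$ (is an $\mathbb{H}$-representation) if independent sets correspond to linearly independent column sets over $\mathbb{C}$. Row vectors; $M^{\mathrm H}$ conjugate transpose. $\Lambda^*_{\mathcal{E}}(M)=\mathrm{row}_{\mathbb{C}}(M)\cap\mathcal{E}^n$, $\Lambda_{\mathcal{E}}(M)=\{v\in\mathbb{C}^n:vM^{\mathrm H}=0\}\cap\mathcal{E}^n$, $\mathrm{Jac}(M)=\mathcal{E}^n/(\Lambda_{\mathcal{E}}(M)\oplus\Lambda^*_{\mathcal{E}}(M))$. -}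

module Defs where

open import Data.Nat using (ℕ; zero; suc)
open import Data.Fin using (Fin; zero; suc; punchIn; _<_)
open import Data.Fin.Subset using (Subset; _∈_; _∉_; _⊆_; ⊥; _∪_; ⁅_⁆; ∣_∣)
open import Data.Rational using (ℚ; 0ℚ; 1ℚ; -_) renaming (_+_ to _+ℚ_; _*_ to _*ℚ_)
open import Data.Product using (Σ; ∃; ∃₂; _×_; _,_)
open import Data.Sum using (_⊎_)
open import Relation.Binary.PropositionalEquality using (_≡_)
import Data.Nat as ℕ

-- The cyclotomic field K = ℚ(ω), ω = e^{2πi/6}, minimal polynomial
-- ω² - ω + 1 = 0.  An element  a + b ω  is stored as the pair (a , b).
-- K is the subfield of ℂ generated by ω; all matrices in the statement
-- have entries in ℤ[ω] ⊆ K.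

record K : Set where
  constructor _+_ω
  field
    re : ℚ
    im : ℚ
open K public

0K 1K ωK : K
0K = 0ℚ + 0ℚ ω
1K = 1ℚ + 0ℚ ω
ωK = 0ℚ + 1ℚ ω

infixl 6 _+K_
infixl 7 _*K_

_+K_ : K → K → K
(a + b ω) +K (c + d ω) = (a +ℚ c) + (b +ℚ d) ω

-K_ : K → K
-K (a + b ω) = (- a) + (- b) ω

-- (a + bω)(c + dω) = (ac - bd) + (ad + bc + bd) ω   using ω² = ω - 1
_*K_ : K → K → K
(a + b ω) *K (c + d ω) =
  ((a *ℚ c) +ℚ (- (b *ℚ d))) + ((a *ℚ d) +ℚ (b *ℚ c) +ℚ (b *ℚ d)) ω

-- complex conjugation: ω̄ = ω⁻¹ = 1 - ω, so conj(a + bω) = (a + b) - bω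
conj : K → K
conj (a + b ω) = (a +ℚ b) + (- b) ω

_^K_ : K → ℕ → K
x ^K zero  = 1K
x ^K suc k = x *K (x ^K k)

-- Eisenstein integers ℰ = ℤ[ω] inside K: both coordinates integral
IsIntegralℚ : ℚ → Set
IsIntegralℚ q = ℚ.denominatorℕ q ≡ 1

Isℰ : K → Set
Isℰ x = IsIntegralℚ (re x) × IsIntegralℚ (im x)

Inℍ : K → Set
Inℍ x = (x ≡ 0K) ⊎ (x ^K 6 ≡ 1K)

sumK : ∀ {n} → (Fin n → K) → K
sumK {zero}  f = 0K
sumK {suc n} f = f zero +K sumK (λ i → f (suc i))

Vecℰ : ℕ → Set
Vecℰ n = Fin n → K

Mat : ℕ → ℕ → Set
Mat m n = Fin m → Fin n → K

sgn : ∀ {n} → Fin n → K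
sgn zero    = 1K
sgn (suc j) = -K (sgn j)

det : ∀ {k} → Mat k k → K
det {zero}  A = 1K
det {suc k} A = sumK (λ j → sgn j *K A zero j *K det (λ a b → A (suc a) (punchIn j b)))

StrictlyIncreasing : ∀ {k m} → (Fin k → Fin m) → Set
StrictlyIncreasing f = ∀ i j → i < j → f i < f j

Isℍmatrix : ∀ {m n} → Mat m n → Set
Isℍmatrix {m} {n} M =
  ∀ (k : ℕ) (rows : Fin k → Fin m) (cols : Fin k → Fin n) →
  StrictlyIncreasing rows → StrictlyIncreasing cols →
  Inℍ (det (λ a b → M (rows a) (cols b)))

record Matroid (n : ℕ) : Set₁ where
  field
    Indep    : Subset n → Set
    indep-⊥  : Indep ⊥
    indep-⊆  : ∀ {A B} → A ⊆ B → Indep B → Indep A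
    exchange : ∀ {A B} → Indep A → Indep B → ∣ A ∣ ℕ.< ∣ B ∣ →
               ∃ λ x → x ∈ B × x ∉ A × Indep (A ∪ ⁅ x ⁆)
open Matroid public

HasRank : ∀ {n} → Matroid n → ℕ → Set
HasRank 𝓜 r = (∃ λ A → Indep 𝓜 A × ∣ A ∣ ≡ r) × (∀ A → Indep 𝓜 A → ∣ A ∣ ℕ.≤ r)

ColsIndep : ∀ {m n} → Mat m n → Subset n → Set
ColsIndep {m} {n} M S =
  ∀ (c : Fin n → K) → (∀ j → j ∉ S → c j ≡ 0K) →
  (∀ i → sumK (λ j → M i j *K c j) ≡ 0K) → ∀ j → c j ≡ 0K

Represents : ∀ {m n} → Mat m n → Matroid n → Set
Represents M 𝓜 = ∀ S → (Indep 𝓜 S → ColsIndep M S) × (ColsIndep M S → Indep 𝓜 S)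

InΛ* : ∀ {m n} → Mat m n → Vecℰ n → Set
InΛ* {m} M v = (∀ j → Isℰ (v j)) ×
  (∃ λ (c : Fin m → K) → ∀ j → sumK (λ i → c i *K M i j) ≡ v j)

InΛ : ∀ {m n} → Mat m n → Vecℰ n → Set
InΛ M v = (∀ j → Isℰ (v j)) × (∀ i → sumK (λ j → v j *K conj (M i j)) ≡ 0K)

-- Λ_ℰ(M) ⊕ Λ*_ℰ(M), the subgroup of ℰⁿ whose quotient is Jac(M)
InΛ⊕Λ* : ∀ {m n} → Mat m n → Vecℰ n → Set
InΛ⊕Λ* M v = ∃₂ λ a b → InΛ M a × InΛ* M b × (∀ j → v j ≡ a j +K b j)

{-# OPTIONS --safe #-}
module Submission where

-- All linear algebra takes place over K = ℚ(ω), which is a field because the norm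
-- a² + ab + b² of a nonzero a + bω is positive.  Choose greedily a row basis of M: rows
-- that are linearly independent and span every row of M.  The selected submatrix M′ and M
-- span each other's rows, so they have the same column dependencies (hence represent the
-- same matroid), the same row space (hence the same Λ*), and, after complex conjugation,
-- the same solutions of v Mᴴ = 0 (hence the same Λ); minors of M′ are minors of M.
-- The number k of selected rows is r.  Gaussian elimination shows that independent vectors
-- are at most as many as their coordinates, so a basis A of the matroid, being r independent
-- columns of M′ in Kᵏ, gives r ≤ k.  If k > |A|, some nonzero combination u of the rows of
-- M′ vanishes on A; a column j with uⱼ ≠ 0 then extends A to a larger independent set.

open import Algebra.Bundles using (CommutativeRing)
open import Algebra.Structures using (IsCommutativeRing)
import Algebra.Properties.Semiring.Sum as SemiringSum
import Algebra.Solver.Ring.Simple as Solver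
open import Algebra.Solver.Ring.AlmostCommutativeRing using (fromCommutativeRing)
open import Data.Empty using (⊥-elim)
open import Data.Fin using (Fin; zero; suc; punchIn)
open import Data.Fin.Properties using (punchInᵢ≢i; any?) renaming (_≟_ to _≟ᶠ_)
open import Data.Fin.Subset using (Subset; _∈_; _∉_; _∪_; _-_; ⁅_⁆; ∣_∣; ⊤; inside; outside)
open import Data.Fin.Subset.Properties
  using (_∈?_; ∈⊤; nonempty?; Empty-unique; ∣⊥∣≡0; ∣⊤∣≡n; p─⊥≡p; p─q⊆p; x∈p∧x≢y⇒x∈p-y;
         p⊆p∪q; x∈p∪q⁺; x∈p∪q⁻; x∈⁅x⁆; x∈⁅y⁆⇒x≡y; p⊂q⇒∣p∣<∣q∣)
open import Data.Integer using (+_; +[1+_]; -[1+_])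
open import Data.Nat using (ℕ; zero; suc; _≤_; _<_; z≤n; s≤s)
open import Data.Nat.Properties using (m≤n⇒m≤1+n; ≤-reflexive; ≤-antisym; <-irrefl; <-≤-trans)
open import Data.Product as Product using (Σ; ∃; _×_; _,_; proj₁; proj₂)
open import Data.Rational as ℚ using (ℚ; mkℚ; 0ℚ; 1ℚ; ½; 1/_; _/_; Positive; NonNegative)
import Data.Rational.Properties as ℚ
open import Data.Rational.Solver using (module +-*-Solver)
open import Data.Sum as Sum using (_⊎_; inj₁; inj₂)
open import Data.Vec.Base using ([]; _∷_; here; there)
open import Data.Vec.Functional
  using (Vector; map; tail; replicate; removeAt; updateAt; transpose) renaming (_∷_ to _∷ᵥ_)
open import Data.Vec.Functional.Properties using (updateAt-updates; updateAt-minimal)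
open import Function using (_∘_)
open import Function.Bundles using (_⇔_; mk⇔)
open import Relation.Binary.Definitions using (DecidableEquality)
open import Relation.Binary.PropositionalEquality
open import Relation.Nullary using (¬_; yes; no; contradiction)
open import Relation.Nullary.Decidable using (map′; _×-dec_; ¬?; decidable-stable)

open import Defs

-- N(a + bω) = a² + ab + b²
norm : K → ℚ
norm x = re (x *K conj x)

embed : ℚ → K
embed q = q + 0ℚ ω

module _ where
  open +-*-Solver

  +K-assoc : ∀ x y z → (x +K y) +K z ≡ x +K (y +K z)
  +K-assoc (a + b ω) (c + d ω) (e + f ω) = cong₂ _+_ω (ℚ.+-assoc a c e) (ℚ.+-assoc b d f)

  +K-comm : ∀ x y → x +K y ≡ y +K x
  +K-comm (a + b ω) (c + d ω) = cong₂ _+_ω (ℚ.+-comm a c) (ℚ.+-comm b d)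

  +K-identityˡ : ∀ x → 0K +K x ≡ x
  +K-identityˡ (a + b ω) = cong₂ _+_ω (ℚ.+-identityˡ a) (ℚ.+-identityˡ b)

  +K-identityʳ : ∀ x → x +K 0K ≡ x
  +K-identityʳ x = trans (+K-comm x 0K) (+K-identityˡ x)

  -K-inverseˡ : ∀ x → -K x +K x ≡ 0K
  -K-inverseˡ (a + b ω) = cong₂ _+_ω (ℚ.+-inverseˡ a) (ℚ.+-inverseˡ b)

  -K-inverseʳ : ∀ x → x +K -K x ≡ 0K
  -K-inverseʳ x = trans (+K-comm x (-K x)) (-K-inverseˡ x)

  *K-assoc : ∀ x y z → (x *K y) *K z ≡ x *K (y *K z)
  *K-assoc (a + b ω) (c + d ω) (e + f ω) = cong₂ _+_ω
    (solve 6 (λ a b c d e f →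
        (a :* c :+ :- (b :* d)) :* e :+ :- ((a :* d :+ b :* c :+ b :* d) :* f)
      := a :* (c :* e :+ :- (d :* f)) :+ :- (b :* (c :* f :+ d :* e :+ d :* f))) refl a b c d e f)
    (solve 6 (λ a b c d e f →
        (a :* c :+ :- (b :* d)) :* f :+ (a :* d :+ b :* c :+ b :* d) :* e :+ (a :* d :+ b :* c :+ b :* d) :* f
      := a :* (c :* f :+ d :* e :+ d :* f) :+ b :* (c :* e :+ :- (d :* f)) :+ b :* (c :* f :+ d :* e :+ d :* f))
      refl a b c d e f)

  *K-comm : ∀ x y → x *K y ≡ y *K x
  *K-comm (a + b ω) (c + d ω) = cong₂ _+_ω
    (solve 4 (λ a b c d → a :* c :+ :- (b :* d) := c :* a :+ :- (d :* b)) refl a b c d)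
    (solve 4 (λ a b c d → a :* d :+ b :* c :+ b :* d := c :* b :+ d :* a :+ d :* b) refl a b c d)

  *K-identityˡ : ∀ x → 1K *K x ≡ x
  *K-identityˡ (a + b ω) = cong₂ _+_ω
    (solve 2 (λ a b → con 1ℚ :* a :+ :- (con 0ℚ :* b) := a) refl a b)
    (solve 2 (λ a b → con 1ℚ :* b :+ con 0ℚ :* a :+ con 0ℚ :* b := b) refl a b)

  *K-identityʳ : ∀ x → x *K 1K ≡ x
  *K-identityʳ x = trans (*K-comm x 1K) (*K-identityˡ x)

  *K-distribˡ-+K : ∀ x y z → x *K (y +K z) ≡ x *K y +K x *K z
  *K-distribˡ-+K (a + b ω) (c + d ω) (e + f ω) = cong₂ _+_ω
    (solve 6 (λ a b c d e f → a :* (c :+ e) :+ :- (b :* (d :+ f))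
      := (a :* c :+ :- (b :* d)) :+ (a :* e :+ :- (b :* f))) refl a b c d e f)
    (solve 6 (λ a b c d e f → a :* (d :+ f) :+ b :* (c :+ e) :+ b :* (d :+ f)
      := (a :* d :+ b :* c :+ b :* d) :+ (a :* f :+ b :* e :+ b :* f)) refl a b c d e f)

  *K-distribʳ-+K : ∀ x y z → (y +K z) *K x ≡ y *K x +K z *K x
  *K-distribʳ-+K x y z = begin
    (y +K z) *K x      ≡⟨ *K-comm (y +K z) x ⟩
    x *K (y +K z)      ≡⟨ *K-distribˡ-+K x y z ⟩
    x *K y +K x *K z   ≡⟨ cong₂ _+K_ (*K-comm x y) (*K-comm x z) ⟩
    y *K x +K z *K x   ∎
    where open ≡-Reasoning

  *K-conj : ∀ x → x *K conj x ≡ embed (norm x)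
  *K-conj (a + b ω) = cong₂ _+_ω refl
    (solve 2 (λ a b → a :* :- b :+ b :* (a :+ b) :+ b :* :- b := con 0ℚ) refl a b)

  embed-* : ∀ p q → embed p *K embed q ≡ embed (p ℚ.* q)
  embed-* p q = cong₂ _+_ω
    (solve 2 (λ p q → p :* q :+ :- (con 0ℚ :* con 0ℚ) := p :* q) refl p q)
    (solve 2 (λ p q → p :* con 0ℚ :+ con 0ℚ :* q :+ con 0ℚ :* con 0ℚ := con 0ℚ) refl p q)

  square-nonNegative : ∀ p → NonNegative (p ℚ.* p)
  square-nonNegative p@(mkℚ (+ _)    _ _) = ℚ.nonNeg*nonNeg⇒nonNeg p p
  square-nonNegative p@(mkℚ -[1+ _ ] _ _) = ℚ.nonPos*nonPos⇒nonPos p p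

  square-positive : ∀ p → p ≢ 0ℚ → Positive (p ℚ.* p)
  square-positive p@(mkℚ +[1+ _ ] _ _) _   = ℚ.pos*pos⇒pos p p
  square-positive p@(mkℚ -[1+ _ ] _ _) _   = ℚ.neg*neg⇒pos p p
  square-positive p@(mkℚ (+ 0)    _ _) p≢0 = ⊥-elim (p≢0 (ℚ.↥p≡0⇒p≡0 p refl))

  norm-positive : ∀ {x} → x ≢ 0K → Positive (norm x)
  norm-positive {a + b ω} x≢0 with b ℚ.≟ 0ℚ
  ... | yes refl = subst Positive (sym norm≡a²) (square-positive a λ { refl → x≢0 refl })
    where
    norm≡a² : norm (a + 0ℚ ω) ≡ a ℚ.* a
    norm≡a² = solve 1 (λ a → a :* (a :+ con 0ℚ) :+ :- (con 0ℚ :* :- con 0ℚ) := a :* a) refl a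
  ... | no b≢0 = subst Positive (sym norm≡sum-of-squares)
    (ℚ.nonNeg+pos⇒pos (c ℚ.* c) {{square-nonNegative c}} (¾ ℚ.* (b ℚ.* b))
      {{ℚ.pos*pos⇒pos ¾ (b ℚ.* b) {{square-positive b b≢0}}}})
    where
    ¾ c : ℚ
    ¾ = + 3 / 4
    c = a ℚ.+ ½ ℚ.* b
    norm≡sum-of-squares : norm (a + b ω) ≡ c ℚ.* c ℚ.+ ¾ ℚ.* (b ℚ.* b)
    norm≡sum-of-squares = solve 2 (λ a b → a :* (a :+ b) :+ :- (b :* :- b)
      := (a :+ con ½ :* b) :* (a :+ con ½ :* b) :+ con ¾ :* (b :* b)) refl a b

  conj-+K : ∀ x y → conj (x +K y) ≡ conj x +K conj y
  conj-+K (a + b ω) (c + d ω) = cong₂ _+_ω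
    (solve 4 (λ a b c d → (a :+ c) :+ (b :+ d) := (a :+ b) :+ (c :+ d)) refl a b c d)
    (solve 4 (λ a b c d → :- (b :+ d) := :- b :+ :- d) refl a b c d)

  conj-*K : ∀ x y → conj (x *K y) ≡ conj x *K conj y
  conj-*K (a + b ω) (c + d ω) = cong₂ _+_ω
    (solve 4 (λ a b c d → (a :* c :+ :- (b :* d)) :+ (a :* d :+ b :* c :+ b :* d)
      := (a :+ b) :* (c :+ d) :+ :- (:- b :* :- d)) refl a b c d)
    (solve 4 (λ a b c d → :- (a :* d :+ b :* c :+ b :* d)
      := (a :+ b) :* :- d :+ :- b :* (c :+ d) :+ :- b :* :- d) refl a b c d)

K-isCommutativeRing : IsCommutativeRing _≡_ _+K_ _*K_ -K_ 0K 1K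
K-isCommutativeRing = record
  { isRing = record
    { +-isAbelianGroup = record
      { isGroup = record
        { isMonoid = record
          { isSemigroup = record
            { isMagma = record { isEquivalence = isEquivalence ; ∙-cong = cong₂ _+K_ }
            ; assoc = +K-assoc }
          ; identity = +K-identityˡ , +K-identityʳ }
        ; inverse = -K-inverseˡ , -K-inverseʳ
        ; ⁻¹-cong = cong -K_ }
      ; comm = +K-comm }
    ; *-cong = cong₂ _*K_
    ; *-assoc = *K-assoc
    ; *-identity = *K-identityˡ , *K-identityʳ
    ; distrib = *K-distribˡ-+K , *K-distribʳ-+K }
  ; *-comm = *K-comm }

K-commutativeRing : CommutativeRing _ _
K-commutativeRing = record { isCommutativeRing = K-isCommutativeRing }

_≟K_ : DecidableEquality K
(a + b ω) ≟K (c + d ω) =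
  map′ (λ (a≡c , b≡d) → cong₂ _+_ω a≡c b≡d) (λ { refl → refl , refl }) ((a ℚ.≟ c) ×-dec (b ℚ.≟ d))

module K-Solver = Solver (fromCommutativeRing K-commutativeRing) _≟K_
open K-Solver using (solve; _:+_; _:*_; :-_; _:=_; con)
open CommutativeRing K-commutativeRing using () renaming (zeroˡ to *K-zeroˡ; zeroʳ to *K-zeroʳ)

inverse : ∀ {x} → x ≢ 0K → ∃ λ y → x *K y ≡ 1K
inverse {x} x≢0 = conj x *K embed (1/ norm x) , (begin
  x *K (conj x *K embed (1/ norm x))   ≡⟨ *K-assoc x (conj x) _ ⟨
  x *K conj x *K embed (1/ norm x)     ≡⟨ cong (_*K embed (1/ norm x)) (*K-conj x) ⟩
  embed (norm x) *K embed (1/ norm x)  ≡⟨ embed-* (norm x) (1/ norm x) ⟩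
  embed (norm x ℚ.* 1/ norm x)         ≡⟨ cong embed (ℚ.*-inverseʳ (norm x)) ⟩
  1K                                   ∎)
  where
  open ≡-Reasoning
  instance
    norm≢0 : ℚ.NonZero (norm x)
    norm≢0 = ℚ.pos⇒nonZero (norm x) {{norm-positive x≢0}}

1K≢0K : 1K ≢ 0K
1K≢0K ()

x≢0∧x*y≡0⇒y≡0 : ∀ {x y} → x ≢ 0K → x *K y ≡ 0K → y ≡ 0K
x≢0∧x*y≡0⇒y≡0 {x} {y} x≢0 xy≡0 = cancel (inverse x≢0)
  where
  cancel : ∃ (λ x⁻¹ → x *K x⁻¹ ≡ 1K) → y ≡ 0K
  cancel (x⁻¹ , xx⁻¹≡1) = begin
    y                  ≡⟨ *K-identityˡ y ⟨
    1K *K y            ≡⟨ cong (_*K y) (trans (sym xx⁻¹≡1) (*K-comm x x⁻¹)) ⟩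
    x⁻¹ *K x *K y      ≡⟨ *K-assoc x⁻¹ x y ⟩
    x⁻¹ *K (x *K y)    ≡⟨ cong (x⁻¹ *K_) xy≡0 ⟩
    x⁻¹ *K 0K          ≡⟨ *K-zeroʳ x⁻¹ ⟩
    0K                 ∎
    where open ≡-Reasoning

x≢0∧y≢0⇒x*y≢0 : ∀ {x y} → x ≢ 0K → y ≢ 0K → x *K y ≢ 0K
x≢0∧y≢0⇒x*y≢0 x≢0 y≢0 xy≡0 = y≢0 (x≢0∧x*y≡0⇒y≡0 x≢0 xy≡0)

private variable
  k m n : ℕ

open SemiringSum (CommutativeRing.semiring K-commutativeRing)
  using (sum; sum-cong-≗; ∑-distrib-+; ∑-comm; *-distribˡ-sum; sum-remove; sum-replicate-zero)

sumK≡sum : (f : Vector K n) → sumK f ≡ sum f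
sumK≡sum {zero}  f = refl
sumK≡sum {suc n} f = cong (f zero +K_) (sumK≡sum (tail f))

sumK-cong : {f g : Vector K n} → f ≗ g → sumK f ≡ sumK g
sumK-cong {f = f} {g} f≗g = begin
  sumK f  ≡⟨ sumK≡sum f ⟩
  sum f   ≡⟨ sum-cong-≗ f≗g ⟩
  sum g   ≡⟨ sumK≡sum g ⟨
  sumK g  ∎
  where open ≡-Reasoning

sumK-zero : {f : Vector K n} → (∀ i → f i ≡ 0K) → sumK f ≡ 0K
sumK-zero {n} {f} f≡0 = begin
  sumK f              ≡⟨ sumK-cong f≡0 ⟩
  sumK (replicate n 0K) ≡⟨ sumK≡sum (replicate n 0K) ⟩
  sum (replicate n 0K) ≡⟨ sum-replicate-zero n ⟩
  0K                  ∎
  where open ≡-Reasoning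

sumK-single : (f : Vector K n) (p : Fin n) → (∀ i → i ≢ p → f i ≡ 0K) → sumK f ≡ f p
sumK-single {suc n} f p f≡0 = begin
  sumK f                     ≡⟨ sumK≡sum f ⟩
  sum f                      ≡⟨ sum-remove f ⟩
  f p +K sum (removeAt f p)  ≡⟨ cong (f p +K_) (trans (sum-cong-≗ off-p≡0) (sum-replicate-zero n)) ⟩
  f p +K 0K                  ≡⟨ +K-identityʳ (f p) ⟩
  f p                        ∎
  where
  open ≡-Reasoning
  off-p≡0 : removeAt f p ≗ replicate n 0K
  off-p≡0 i = f≡0 (punchIn p i) (punchInᵢ≢i p i)

sumK-+K : (f g : Vector K n) → sumK (λ i → f i +K g i) ≡ sumK f +K sumK g
sumK-+K f g = begin
  sumK (λ i → f i +K g i)  ≡⟨ sumK≡sum _ ⟩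
  sum (λ i → f i +K g i)   ≡⟨ ∑-distrib-+ f g ⟩
  sum f +K sum g           ≡⟨ cong₂ _+K_ (sumK≡sum f) (sumK≡sum g) ⟨
  sumK f +K sumK g         ∎
  where open ≡-Reasoning

*K-distribˡ-sumK : (α : K) (f : Vector K n) → α *K sumK f ≡ sumK (λ i → α *K f i)
*K-distribˡ-sumK α f = begin
  α *K sumK f              ≡⟨ cong (α *K_) (sumK≡sum f) ⟩
  α *K sum f               ≡⟨ *-distribˡ-sum α f ⟩
  sum (λ i → α *K f i)     ≡⟨ sumK≡sum _ ⟨
  sumK (λ i → α *K f i)    ∎
  where open ≡-Reasoning

sumK-comm : (f : Fin m → Fin n → K) →
            sumK (λ i → sumK (λ j → f i j)) ≡ sumK (λ j → sumK (λ i → f i j))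
sumK-comm f = begin
  sumK (λ i → sumK (f i))                 ≡⟨ sumK-cong (λ i → sumK≡sum (f i)) ⟩
  sumK (λ i → sum (f i))                  ≡⟨ sumK≡sum _ ⟩
  sum (λ i → sum (f i))                   ≡⟨ ∑-comm f ⟩
  sum (λ j → sum (λ i → f i j))           ≡⟨ sumK≡sum _ ⟨
  sumK (λ j → sum (λ i → f i j))          ≡⟨ sumK-cong (λ j → sumK≡sum (λ i → f i j)) ⟨
  sumK (λ j → sumK (λ i → f i j))         ∎
  where open ≡-Reasoning

conj-sumK : (f : Vector K n) → conj (sumK f) ≡ sumK (λ i → conj (f i))
conj-sumK {zero}  f = refl
conj-sumK {suc n} f = trans (conj-+K (f zero) _) (cong (conj (f zero) +K_) (conj-sumK (tail f)))

infix  8 _*ᵥ_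
infixl 7 _+ᵥ_ _∙_ _ᵛ*_

_+ᵥ_ : Vector K n → Vector K n → Vector K n
(x +ᵥ y) i = x i +K y i

_*ᵥ_ : K → Vector K n → Vector K n
(α *ᵥ x) i = α *K x i

_∙_ : Vector K n → Vector K n → K
x ∙ y = sumK (λ i → x i *K y i)

_ᵛ*_ : Vector K m → Mat m n → Vector K n
(c ᵛ* M) j = c ∙ (λ i → M i j)

unit : Fin n → Vector K n
unit p = updateAt (replicate _ 0K) p (λ _ → 1K)

unit-same : (p : Fin n) → unit p p ≡ 1K
unit-same p = updateAt-updates p (replicate _ 0K)

unit-other : ∀ {i p : Fin n} → i ≢ p → unit p i ≡ 0K
unit-other {i = i} {p} i≢p = updateAt-minimal i p (replicate _ 0K) i≢p

∙-comm : (x y : Vector K n) → x ∙ y ≡ y ∙ x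
∙-comm x y = sumK-cong (λ i → *K-comm (x i) (y i))

∙-+ᵥʳ : (x y z : Vector K n) → x ∙ (y +ᵥ z) ≡ x ∙ y +K x ∙ z
∙-+ᵥʳ x y z = trans (sumK-cong (λ i → *K-distribˡ-+K (x i) (y i) (z i))) (sumK-+K _ _)

∙-*ᵥʳ : (x : Vector K n) (α : K) (y : Vector K n) → x ∙ α *ᵥ y ≡ α *K (x ∙ y)
∙-*ᵥʳ x α y = trans
  (sumK-cong (λ i → solve 3 (λ x α y → x :* (α :* y) := α :* (x :* y)) refl (x i) α (y i)))
  (sym (*K-distribˡ-sumK α _))

∙-*ᵥˡ : (α : K) (x y : Vector K n) → α *ᵥ x ∙ y ≡ α *K (x ∙ y)
∙-*ᵥˡ α x y = trans (∙-comm (α *ᵥ x) y) (trans (∙-*ᵥʳ y α x) (cong (α *K_) (∙-comm y x)))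

∙-linearʳ : (x : Vector K n) (α : K) (y : Vector K n) (β : K) (z : Vector K n) →
            x ∙ (α *ᵥ y +ᵥ β *ᵥ z) ≡ α *K (x ∙ y) +K β *K (x ∙ z)
∙-linearʳ x α y β z =
  trans (∙-+ᵥʳ x (α *ᵥ y) (β *ᵥ z)) (cong₂ _+K_ (∙-*ᵥʳ x α y) (∙-*ᵥʳ x β z))

∙-linearˡ : (α : K) (y : Vector K n) (β : K) (z x : Vector K n) →
            (α *ᵥ y +ᵥ β *ᵥ z) ∙ x ≡ α *K (y ∙ x) +K β *K (z ∙ x)
∙-linearˡ α y β z x = begin
  (α *ᵥ y +ᵥ β *ᵥ z) ∙ x             ≡⟨ ∙-comm _ x ⟩
  x ∙ (α *ᵥ y +ᵥ β *ᵥ z)             ≡⟨ ∙-linearʳ x α y β z ⟩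
  α *K (x ∙ y) +K β *K (x ∙ z)       ≡⟨ cong₂ (λ u v → α *K u +K β *K v) (∙-comm x y) (∙-comm x z) ⟩
  α *K (y ∙ x) +K β *K (z ∙ x)       ∎
  where open ≡-Reasoning

∙-zeroʳ : (x : Vector K n) {y : Vector K n} → (∀ i → y i ≡ 0K) → x ∙ y ≡ 0K
∙-zeroʳ x y≡0 = sumK-zero (λ i → trans (cong (x i *K_) (y≡0 i)) (*K-zeroʳ (x i)))

∙-unitˡ : (p : Fin n) (x : Vector K n) → unit p ∙ x ≡ x p
∙-unitˡ p x = begin
  unit p ∙ x          ≡⟨ sumK-single _ p (λ i i≢p → trans (cong (_*K x i) (unit-other i≢p)) (*K-zeroˡ (x i))) ⟩
  unit p p *K x p     ≡⟨ cong (_*K x p) (unit-same p) ⟩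
  1K *K x p           ≡⟨ *K-identityˡ (x p) ⟩
  x p                 ∎
  where open ≡-Reasoning

ᵛ*-∙-assoc : (c : Vector K m) (A : Mat m n) (y : Vector K n) → (c ᵛ* A) ∙ y ≡ c ∙ (λ i → A i ∙ y)
ᵛ*-∙-assoc c A y = begin
  (c ᵛ* A) ∙ y                                        ≡⟨ ∙-comm _ y ⟩
  sumK (λ j → y j *K sumK (λ i → c i *K A i j))       ≡⟨ sumK-cong (λ j → *K-distribˡ-sumK (y j) _) ⟩
  sumK (λ j → sumK (λ i → y j *K (c i *K A i j)))     ≡⟨ sumK-comm _ ⟨
  sumK (λ i → sumK (λ j → y j *K (c i *K A i j)))     ≡⟨ sumK-cong (λ i → sumK-cong (λ j → reassoc (y j) (c i) (A i j))) ⟩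
  sumK (λ i → sumK (λ j → c i *K (A i j *K y j)))     ≡⟨ sumK-cong (λ i → *K-distribˡ-sumK (c i) _) ⟨
  c ∙ (λ i → A i ∙ y)                                 ∎
  where
  open ≡-Reasoning
  reassoc : ∀ y c a → y *K (c *K a) ≡ c *K (a *K y)
  reassoc = solve 3 (λ y c a → y :* (c :* a) := c :* (a :* y)) refl

conj-∙ : (x y : Vector K n) → conj (x ∙ y) ≡ (λ i → conj (x i)) ∙ (λ i → conj (y i))
conj-∙ x y = trans (conj-sumK _) (sumK-cong (λ i → conj-*K (x i) (y i)))

x∉p-x : (x : Fin n) (p : Subset n) → x ∉ p - x
x∉p-x zero    (_ ∷ p) ()
x∉p-x (suc x) (_ ∷ p) (there x∈p-x) = x∉p-x x p x∈p-x

x∈p⇒∣p∣≡1+∣p-x∣ : {x : Fin n} {p : Subset n} → x ∈ p → ∣ p ∣ ≡ suc ∣ p - x ∣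
x∈p⇒∣p∣≡1+∣p-x∣ {p = inside ∷ p}  here          = cong (suc ∘ ∣_∣) (sym (p─⊥≡p p))
x∈p⇒∣p∣≡1+∣p-x∣ {p = outside ∷ p} (there x∈p) = x∈p⇒∣p∣≡1+∣p-x∣ x∈p
x∈p⇒∣p∣≡1+∣p-x∣ {p = inside ∷ p}  (there x∈p) = cong suc (x∈p⇒∣p∣≡1+∣p-x∣ x∈p)

SupportedOn : Subset m → Vector K m → Set
SupportedOn S c = ∀ i → i ∉ S → c i ≡ 0K

VanishesOn : Subset n → Vector K n → Set
VanishesOn T u = ∀ j → j ∈ T → u j ≡ 0K

IndependentOn : Subset m → Subset n → Mat m n → Set
IndependentOn S T v = ∀ c → SupportedOn S c → VanishesOn T (c ᵛ* v) → ∀ i → c i ≡ 0K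

DependentOn : Subset m → Subset n → Mat m n → Set
DependentOn S T v = ∃ λ c → SupportedOn S c × VanishesOn T (c ᵛ* v) × ∃ λ i → c i ≢ 0K

ᵛ*-updateAt-zeroRow : (c : Vector K m) (p : Fin m) (f : K → K) {M : Mat m n} →
                      (∀ j → M p j ≡ 0K) → ∀ j → (updateAt c p f ᵛ* M) j ≡ (c ᵛ* M) j
ᵛ*-updateAt-zeroRow c p f {M} Mp≡0 j = sumK-cong same-term
  where
  killed : ∀ x → x *K M p j ≡ 0K
  killed x = trans (cong (x *K_) (Mp≡0 j)) (*K-zeroʳ x)
  same-term : ∀ i → updateAt c p f i *K M i j ≡ c i *K M i j
  same-term i with i ≟ᶠ p
  ... | yes refl = trans (killed (updateAt c i f i)) (sym (killed (c i)))
  ... | no i≢p   = cong (_*K M i j) (updateAt-minimal i p c i≢p)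

module _ {S : Subset m} {T : Subset n} {v : Mat m (suc n)} where

  independentOn-∷ : ∀ {s} → IndependentOn S T (map tail v) → IndependentOn S (s ∷ T) v
  independentOn-∷ independent c supported vanishes =
    independent c supported (λ j j∈T → vanishes (suc j) (there j∈T))

  dependentOn-outside : DependentOn S T (map tail v) → DependentOn S (outside ∷ T) v
  dependentOn-outside (c , supported , vanishes , nonzero) =
    c , supported , (λ { (suc j) (there j∈T) → vanishes j j∈T }) , nonzero

  dependentOn-zeroColumn : (∀ i → i ∈ S → v i zero ≡ 0K) →
                           DependentOn S T (map tail v) → DependentOn S (inside ∷ T) v
  dependentOn-zeroColumn column≡0 (c , supported , vanishes , nonzero) =
    c , supported , vanishes′ , nonzero
    where
    term≡0 : ∀ i → c i *K v i zero ≡ 0K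
    term≡0 i with i ∈? S
    ... | yes i∈S = trans (cong (c i *K_) (column≡0 i i∈S)) (*K-zeroʳ (c i))
    ... | no  i∉S = trans (cong (_*K v i zero) (supported i i∉S)) (*K-zeroˡ (v i zero))
    vanishes′ : VanishesOn (inside ∷ T) (c ᵛ* v)
    vanishes′ zero    here        = sumK-zero term≡0
    vanishes′ (suc j) (there j∈T) = vanishes j j∈T

module Elimination {S : Subset m} {T : Subset n} (v : Mat m (suc n))
                   {p : Fin m} (p∈S : p ∈ S) (pivot≢0 : v p zero ≢ 0K) where

  a : K
  a = v p zero

  b : Vector K n
  b = tail (v p)

  -- the column operations  col₁₊ⱼ ↦ a · col₁₊ⱼ − bⱼ · col₀, which clear the pivot row p
  eliminated : Mat m n
  eliminated i j = a *K v i (suc j) +K (-K b j) *K v i zero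

  ᵛ*-eliminated : (c : Vector K m) (j : Fin n) →
                  (c ᵛ* eliminated) j ≡ a *K (c ᵛ* v) (suc j) +K (-K b j) *K (c ᵛ* v) zero
  ᵛ*-eliminated c j = ∙-linearʳ c a (λ i → v i (suc j)) (-K b j) (λ i → v i zero)

  eliminated-pivotRow : ∀ j → eliminated p j ≡ 0K
  eliminated-pivotRow j = solve 2 (λ a b → a :* b :+ :- b :* a := con 0K) refl a (b j)

  eliminate-independent : IndependentOn (S - p) T eliminated → IndependentOn S (inside ∷ T) v
  eliminate-independent independent c supported vanishes = c≡0
    where
    open ≡-Reasoning
    c′ : Vector K m
    c′ = updateAt c p (λ _ → 0K)
    c′-supported : SupportedOn (S - p) c′
    c′-supported i i∉S-p with i ≟ᶠ p
    ... | yes refl = updateAt-updates i c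
    ... | no  i≢p  = trans (updateAt-minimal i p c i≢p)
                           (supported i (λ i∈S → i∉S-p (x∈p∧x≢y⇒x∈p-y i∈S i≢p)))
    c′-vanishes : VanishesOn T (c′ ᵛ* eliminated)
    c′-vanishes j j∈T = begin
      (c′ ᵛ* eliminated) j
        ≡⟨ ᵛ*-updateAt-zeroRow c p _ eliminated-pivotRow j ⟩
      (c ᵛ* eliminated) j
        ≡⟨ ᵛ*-eliminated c j ⟩
      a *K (c ᵛ* v) (suc j) +K (-K b j) *K (c ᵛ* v) zero
        ≡⟨ cong₂ (λ x y → a *K x +K (-K b j) *K y) (vanishes (suc j) (there j∈T)) (vanishes zero here) ⟩
      a *K 0K +K (-K b j) *K 0K
        ≡⟨ solve 2 (λ a b → a :* con 0K :+ b :* con 0K := con 0K) refl a (-K b j) ⟩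
      0K ∎
    c≡0-off-pivot : ∀ i → i ≢ p → c i ≡ 0K
    c≡0-off-pivot i i≢p =
      trans (sym (updateAt-minimal i p c i≢p)) (independent c′ c′-supported c′-vanishes i)
    c≡0-at-pivot : c p ≡ 0K
    c≡0-at-pivot = x≢0∧x*y≡0⇒y≡0 pivot≢0 (begin
      a *K c p          ≡⟨ *K-comm a (c p) ⟩
      c p *K a          ≡⟨ sumK-single (λ i → c i *K v i zero) p (λ i i≢p → trans (cong (_*K v i zero) (c≡0-off-pivot i i≢p)) (*K-zeroˡ (v i zero))) ⟨
      (c ᵛ* v) zero     ≡⟨ vanishes zero here ⟩
      0K                ∎)
    c≡0 : ∀ i → c i ≡ 0K
    c≡0 i with i ≟ᶠ p
    ... | yes refl = c≡0-at-pivot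
    ... | no  i≢p  = c≡0-off-pivot i i≢p

  eliminate-dependent : DependentOn (S - p) T eliminated → DependentOn S (inside ∷ T) v
  eliminate-dependent (d , d-supported , d-vanishes , q , d-q≢0) =
    c , c-supported , c-vanishes , q , c-q≢0
    where
    open ≡-Reasoning
    s₀ : K
    s₀ = (d ᵛ* v) zero
    c : Vector K m
    c = a *ᵥ d +ᵥ (-K s₀) *ᵥ unit p
    ᵛ*-c : ∀ j → (c ᵛ* v) j ≡ a *K (d ᵛ* v) j +K (-K s₀) *K v p j
    ᵛ*-c j = trans (∙-linearˡ a d (-K s₀) (unit p) _)
                   (cong (λ x → a *K (d ᵛ* v) j +K (-K s₀) *K x) (∙-unitˡ p (λ i → v i j)))
    c-vanishes : VanishesOn (inside ∷ T) (c ᵛ* v)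
    c-vanishes zero here =
      trans (ᵛ*-c zero) (solve 2 (λ a s → a :* s :+ :- s :* a := con 0K) refl a s₀)
    c-vanishes (suc j) (there j∈T) = begin
      (c ᵛ* v) (suc j)                            ≡⟨ ᵛ*-c (suc j) ⟩
      a *K (d ᵛ* v) (suc j) +K (-K s₀) *K b j     ≡⟨ cong (a *K (d ᵛ* v) (suc j) +K_) (solve 2 (λ s b → :- s :* b := :- b :* s) refl s₀ (b j)) ⟩
      a *K (d ᵛ* v) (suc j) +K (-K b j) *K s₀     ≡⟨ ᵛ*-eliminated d j ⟨
      (d ᵛ* eliminated) j                         ≡⟨ d-vanishes j j∈T ⟩
      0K                                          ∎
    c-supported : SupportedOn S c
    c-supported i i∉S = begin
      a *K d i +K (-K s₀) *K unit p i  ≡⟨ cong₂ (λ x y → a *K x +K (-K s₀) *K y) d-i≡0 (unit-other i≢p) ⟩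
      a *K 0K +K (-K s₀) *K 0K         ≡⟨ solve 2 (λ a s → a :* con 0K :+ s :* con 0K := con 0K) refl a (-K s₀) ⟩
      0K                               ∎
      where
      d-i≡0 : d i ≡ 0K
      d-i≡0 = d-supported i (λ i∈S-p → i∉S (p─q⊆p S ⁅ p ⁆ i∈S-p))
      i≢p : i ≢ p
      i≢p refl = i∉S p∈S
    c-q≢0 : c q ≢ 0K
    c-q≢0 c-q≡0 = x≢0∧y≢0⇒x*y≢0 pivot≢0 d-q≢0 (begin
      a *K d q                          ≡⟨ +K-identityʳ (a *K d q) ⟨
      a *K d q +K 0K                    ≡⟨ cong (a *K d q +K_) (trans (cong ((-K s₀) *K_) (unit-other q≢p)) (*K-zeroʳ (-K s₀))) ⟨
      a *K d q +K (-K s₀) *K unit p q   ≡⟨ c-q≡0 ⟩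
      0K                                ∎)
      where
      q≢p : q ≢ p
      q≢p refl = d-q≢0 (d-supported q (x∉p-x q S))

independent≤⊎dependent : ∀ n (S : Subset m) (T : Subset n) (v : Mat m n) →
                         (IndependentOn S T v × ∣ S ∣ ≤ ∣ T ∣) ⊎ DependentOn S T v
independent≤⊎dependent {m} zero S [] v with nonempty? S
... | yes (p , p∈S) = inj₂ (unit p , unit-supported , (λ ()) , p , unit-p≢0)
  where
  unit-supported : SupportedOn S (unit p)
  unit-supported i i∉S = unit-other {i = i} {p} (λ { refl → i∉S p∈S })
  unit-p≢0 : unit p p ≢ 0K
  unit-p≢0 = 1K≢0K ∘ trans (sym (unit-same p))
... | no  S-empty =
  inj₁ (independent , subst (λ S → ∣ S ∣ ≤ 0) (sym (Empty-unique S-empty)) (≤-reflexive (∣⊥∣≡0 m)))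
  where
  independent : IndependentOn S [] v
  independent c supported _ i = supported i (λ i∈S → S-empty (i , i∈S))
independent≤⊎dependent (suc n) S (outside ∷ T) v =
  Sum.map (Product.map₁ independentOn-∷) dependentOn-outside
    (independent≤⊎dependent n S T (map tail v))
independent≤⊎dependent (suc n) S (inside ∷ T) v
  with any? (λ i → (i ∈? S) ×-dec ¬? (v i zero ≟K 0K))
... | no no-pivot =
  Sum.map (Product.map independentOn-∷ m≤n⇒m≤1+n) (dependentOn-zeroColumn column≡0)
    (independent≤⊎dependent n S T (map tail v))
  where
  column≡0 : ∀ i → i ∈ S → v i zero ≡ 0K
  column≡0 i i∈S = decidable-stable (v i zero ≟K 0K) (λ v-i≢0 → no-pivot (i , i∈S , v-i≢0))
... | yes (p , p∈S , pivot≢0) =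
  Sum.map (Product.map eliminate-independent size-bound) eliminate-dependent
    (independent≤⊎dependent n (S - p) T eliminated)
  where
  open Elimination v p∈S pivot≢0
  size-bound : ∣ S - p ∣ ≤ ∣ T ∣ → ∣ S ∣ ≤ suc ∣ T ∣
  size-bound bound = subst (_≤ suc ∣ T ∣) (sym (x∈p⇒∣p∣≡1+∣p-x∣ p∈S)) (s≤s bound)

InRowSpace : Mat k n → Vector K n → Set
InRowSpace N v = ∃ λ d → ∀ j → (d ᵛ* N) j ≡ v j

RowsSpannedBy : Mat m n → Mat k n → Set
RowsSpannedBy M N = ∀ i → InRowSpace N (M i)

row∈rowSpace : (N : Mat k n) (a : Fin k) → InRowSpace N (N a)
row∈rowSpace N a = unit a , λ j → ∙-unitˡ a (λ b → N b j)

selection-spanned : (M : Mat m n) (rows : Fin k → Fin m) → RowsSpannedBy (λ a → M (rows a)) M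
selection-spanned M rows a = row∈rowSpace M (rows a)

rowSpace-∷ : {N : Mat k n} {v : Vector K n} (r : Vector K n) → InRowSpace N v → InRowSpace (r ∷ᵥ N) v
rowSpace-∷ {N = N} r (d , dN≡v) = 0K ∷ᵥ d , λ j →
  trans (cong (_+K (d ᵛ* N) j) (*K-zeroˡ (r j))) (trans (+K-identityˡ _) (dN≡v j))

rowSpace-trans : {M : Mat m n} {N : Mat k n} {v : Vector K n} →
                 RowsSpannedBy M N → InRowSpace M v → InRowSpace N v
rowSpace-trans {m = m} {k = k} {M = M} {N = N} {v = v} M⊆N (c , cM≡v) = c ᵛ* D , λ j → begin
  (c ᵛ* D ᵛ* N) j            ≡⟨ ᵛ*-∙-assoc c D (λ a → N a j) ⟩
  c ∙ (λ i → (D i ᵛ* N) j)   ≡⟨ sumK-cong (λ i → cong (c i *K_) (proj₂ (M⊆N i) j)) ⟩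
  (c ᵛ* M) j                 ≡⟨ cM≡v j ⟩
  v j                        ∎
  where
  open ≡-Reasoning
  D : Mat m k
  D i = proj₁ (M⊆N i)

spanned-annihilated : {M : Mat m n} {N : Mat k n} {x : Vector K n} →
                      RowsSpannedBy M N → (∀ a → N a ∙ x ≡ 0K) → ∀ i → M i ∙ x ≡ 0K
spanned-annihilated {M = M} {N = N} {x = x} M⊆N Nx≡0 i with M⊆N i
... | d , dN≡Mi = begin
  M i ∙ x               ≡⟨ sumK-cong (λ j → cong (_*K x j) (sym (dN≡Mi j))) ⟩
  (d ᵛ* N) ∙ x          ≡⟨ ᵛ*-∙-assoc d N x ⟩
  d ∙ (λ a → N a ∙ x)   ≡⟨ ∙-zeroʳ d Nx≡0 ⟩
  0K                    ∎
  where open ≡-Reasoning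

conj-spanned : {M : Mat m n} {N : Mat k n} → RowsSpannedBy M N →
               RowsSpannedBy (λ i j → conj (M i j)) (λ a j → conj (N a j))
conj-spanned {N = N} M⊆N i with M⊆N i
... | d , dN≡Mi = (λ a → conj (d a)) , λ j → trans (sym (conj-∙ d (λ a → N a j))) (cong conj (dN≡Mi j))

module _ {M : Mat m n} {N : Mat k n} (M⊆N : RowsSpannedBy M N) where

  colsIndep-spanned : ∀ {S} → ColsIndep M S → ColsIndep N S
  colsIndep-spanned independent c supported Nc≡0 =
    independent c supported (spanned-annihilated M⊆N Nc≡0)

  -- v Mᴴ = 0 says that the entrywise conjugate of M annihilates v.
  InΛ-spanned : ∀ {v} → InΛ N v → InΛ M v
  InΛ-spanned {v} (integral , vN̄≡0) = integral , λ i → trans (∙-comm v _)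
    (spanned-annihilated (conj-spanned M⊆N) (λ a → trans (∙-comm _ v) (vN̄≡0 a)) i)

  InΛ*-spanned : ∀ {v} → InΛ* M v → InΛ* N v
  InΛ*-spanned (integral , v∈rowSpace) = integral , rowSpace-trans M⊆N v∈rowSpace

module RowEquivalence {M : Mat m n} {N : Mat k n}
                      (M⊆N : RowsSpannedBy M N) (N⊆M : RowsSpannedBy N M) where

  represents : ∀ {𝓜} → Represents M 𝓜 → Represents N 𝓜
  represents rep S = colsIndep-spanned M⊆N ∘ proj₁ (rep S) , proj₂ (rep S) ∘ colsIndep-spanned N⊆M

  InΛ-⇔ : ∀ v → InΛ M v ⇔ InΛ N v
  InΛ-⇔ v = mk⇔ (InΛ-spanned N⊆M {v}) (InΛ-spanned M⊆N {v})

  InΛ*-⇔ : ∀ v → InΛ* M v ⇔ InΛ* N v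
  InΛ*-⇔ v = mk⇔ (InΛ*-spanned M⊆N {v}) (InΛ*-spanned N⊆M {v})

  InΛ⊕Λ*-⇔ : ∀ v → InΛ⊕Λ* M v ⇔ InΛ⊕Λ* N v
  InΛ⊕Λ*-⇔ v = mk⇔
    (λ (a , b , a∈Λ , b∈Λ* , v≡a+b) → a , b , InΛ-spanned N⊆M {a} a∈Λ , InΛ*-spanned M⊆N {b} b∈Λ* , v≡a+b)
    (λ (a , b , a∈Λ , b∈Λ* , v≡a+b) → a , b , InΛ-spanned M⊆N {a} a∈Λ , InΛ*-spanned N⊆M {b} b∈Λ* , v≡a+b)

Isℍmatrix-selection : (M : Mat m n) (rows : Fin k → Fin m) →
                      StrictlyIncreasing rows → Isℍmatrix M → Isℍmatrix (λ i j → M (rows i) j)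
Isℍmatrix-selection M rows rows↑ ℍ l rs cs rs↑ cs↑ =
  ℍ l (rows ∘ rs) cs (λ i j i<j → rows↑ (rs i) (rs j) (rs↑ i j i<j)) cs↑

independent-∷⊎spanned : (r : Vector K n) {N : Mat k n} →
                        IndependentOn ⊤ ⊤ N → IndependentOn ⊤ ⊤ (r ∷ᵥ N) ⊎ InRowSpace N r
independent-∷⊎spanned {n} r {N} independent with independent≤⊎dependent n ⊤ ⊤ (r ∷ᵥ N)
... | inj₁ (independent′ , _) = inj₁ independent′
... | inj₂ (c , _ , vanishes , q , c-q≢0) with c zero ≟K 0K
...   | yes c₀≡0 = ⊥-elim (c-q≢0 (c≡0 q))
  where
  open ≡-Reasoning
  tail-vanishes : ∀ j → (tail c ᵛ* N) j ≡ 0K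
  tail-vanishes j = begin
    (tail c ᵛ* N) j                   ≡⟨ +K-identityˡ _ ⟨
    0K +K (tail c ᵛ* N) j             ≡⟨ cong (_+K (tail c ᵛ* N) j) (trans (cong (_*K r j) c₀≡0) (*K-zeroˡ (r j))) ⟨
    c zero *K r j +K (tail c ᵛ* N) j  ≡⟨ vanishes j ∈⊤ ⟩
    0K                                ∎
  c≡0 : ∀ i → c i ≡ 0K
  c≡0 zero    = c₀≡0
  c≡0 (suc i) = independent (tail c) (λ _ i∉⊤ → contradiction ∈⊤ i∉⊤) (λ j _ → tail-vanishes j) i
...   | no c₀≢0 = inj₂ (r∈rowSpace (inverse c₀≢0))
  where
  r∈rowSpace : ∃ (λ y → c zero *K y ≡ 1K) → InRowSpace N r
  r∈rowSpace (y , c₀y≡1) = (-K y) *ᵥ tail c , λ j → begin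
    ((-K y) *ᵥ tail c ᵛ* N) j
      ≡⟨ ∙-*ᵥˡ (-K y) (tail c) (λ a → N a j) ⟩
    (-K y) *K (tail c ᵛ* N) j
      ≡⟨ solve 4 (λ y c₀ r s → :- y :* s := y :* c₀ :* r :+ :- (y :* (c₀ :* r :+ s))) refl y (c zero) (r j) _ ⟩
    y *K c zero *K r j +K -K (y *K (c zero *K r j +K (tail c ᵛ* N) j))
      ≡⟨ cong₂ (λ u w → u *K r j +K -K (y *K w)) (trans (*K-comm y (c zero)) c₀y≡1) (vanishes j ∈⊤) ⟩
    1K *K r j +K -K (y *K 0K)
      ≡⟨ solve 2 (λ y r → con 1K :* r :+ :- (y :* con 0K) := r) refl y (r j) ⟩
    r j ∎
    where open ≡-Reasoning

record RowBasis (M : Mat m n) : Set where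
  field
    size        : ℕ
    rows        : Fin size → Fin m
    increasing  : StrictlyIncreasing rows
    independent : IndependentOn ⊤ ⊤ (λ a → M (rows a))
    spanning    : RowsSpannedBy M (λ a → M (rows a))

zero∷suc-increasing : {rows : Fin k → Fin m} → StrictlyIncreasing rows →
                      StrictlyIncreasing (zero ∷ᵥ suc ∘ rows)
zero∷suc-increasing rows↑ zero    zero    ()
zero∷suc-increasing rows↑ zero    (suc j) _         = s≤s z≤n
zero∷suc-increasing rows↑ (suc i) zero    ()
zero∷suc-increasing rows↑ (suc i) (suc j) (s≤s i<j) = s≤s (rows↑ i j i<j)

rowBasis : (M : Mat m n) → RowBasis M
rowBasis {zero}  M = record
  { size = 0 ; rows = λ () ; increasing = λ () ; independent = λ _ _ _ () ; spanning = λ () }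
rowBasis {suc m} M = extend (rowBasis (M ∘ suc))
  where
  extend : RowBasis (M ∘ suc) → RowBasis M
  extend B with independent-∷⊎spanned (M zero) (RowBasis.independent B)
  ... | inj₁ independent′ = record
    { size        = suc size
    ; rows        = zero ∷ᵥ suc ∘ rows
    ; increasing  = zero∷suc-increasing increasing
    ; independent = independent′
    ; spanning    = λ { zero    → row∈rowSpace (M zero ∷ᵥ M ∘ suc ∘ rows) zero
                      ; (suc i) → rowSpace-∷ (M zero) (spanning i) }
    }
    where open RowBasis B
  ... | inj₂ M₀∈rowSpace = record
    { size        = size
    ; rows        = suc ∘ rows
    ; increasing  = λ i j i<j → s≤s (increasing i j i<j)
    ; independent = independent
    ; spanning    = λ { zero → M₀∈rowSpace ; (suc i) → spanning i }
    }
    where open RowBasis B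

independentCols≤rows : {N : Mat k n} {S : Subset n} → ColsIndep N S → ∣ S ∣ ≤ k
independentCols≤rows {k} {N = N} {S} independent
  with independent≤⊎dependent k S ⊤ (transpose N)
... | inj₁ (_ , |S|≤|⊤|) = subst (∣ S ∣ ≤_) (∣⊤∣≡n k) |S|≤|⊤|
... | inj₂ (c , supported , vanishes , j , c-j≢0) =
  contradiction (independent c supported (λ a → trans (∙-comm (N a) c) (vanishes a ∈⊤)) j) c-j≢0

colsIndep-∪⁅⁆ : {N : Mat k n} {A : Subset n} (d : Vector K k) {j : Fin n} →
                ColsIndep N A → VanishesOn A (d ᵛ* N) → (d ᵛ* N) j ≢ 0K → ColsIndep N (A ∪ ⁅ j ⁆)
colsIndep-∪⁅⁆ {N = N} {A} d {j} independent u-vanishes u-j≢0 c supported Nc≡0 =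
  independent c supportedOn-A Nc≡0
  where
  u : Vector K _
  u = d ᵛ* N
  outside-A∪⁅j⁆ : ∀ {l} → l ∉ A → l ≢ j → l ∉ A ∪ ⁅ j ⁆
  outside-A∪⁅j⁆ l∉A l≢j l∈A∪⁅j⁆ = Sum.[ l∉A , l≢j ∘ x∈⁅y⁆⇒x≡y j ]′ (x∈p∪q⁻ A ⁅ j ⁆ l∈A∪⁅j⁆)
  term≡0 : ∀ l → l ≢ j → u l *K c l ≡ 0K
  term≡0 l l≢j with l ∈? A
  ... | yes l∈A = trans (cong (_*K c l) (u-vanishes l l∈A)) (*K-zeroˡ (c l))
  ... | no  l∉A = trans (cong (u l *K_) (supported l (outside-A∪⁅j⁆ l∉A l≢j))) (*K-zeroʳ (u l))
  c-j≡0 : c j ≡ 0K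
  c-j≡0 = x≢0∧x*y≡0⇒y≡0 u-j≢0 (begin
    u j *K c j   ≡⟨ sumK-single (λ l → u l *K c l) j term≡0 ⟨
    u ∙ c        ≡⟨ ᵛ*-∙-assoc d N c ⟩
    d ∙ (λ a → N a ∙ c) ≡⟨ ∙-zeroʳ d Nc≡0 ⟩
    0K           ∎)
    where open ≡-Reasoning
  supportedOn-A : SupportedOn A c
  supportedOn-A l l∉A with l ≟ᶠ j
  ... | yes refl = c-j≡0
  ... | no  l≢j  = supported l (outside-A∪⁅j⁆ l∉A l≢j)

independentRows≤maximalCols : {N : Mat k n} {A : Subset n} →
  IndependentOn ⊤ ⊤ N → ColsIndep N A → (∀ j → j ∉ A → ¬ ColsIndep N (A ∪ ⁅ j ⁆)) → k ≤ ∣ A ∣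
independentRows≤maximalCols {k} {n} {N} {A} rows-independent cols-independent maximal
  with independent≤⊎dependent n ⊤ A N
... | inj₁ (_ , k≤|A|) = subst (_≤ ∣ A ∣) (∣⊤∣≡n k) k≤|A|
... | inj₂ (d , _ , u-vanishes , q , d-q≢0) with any? (λ j → ¬? ((d ᵛ* N) j ≟K 0K))
...   | yes (j , u-j≢0) =
  contradiction (colsIndep-∪⁅⁆ d cols-independent u-vanishes u-j≢0) (maximal j (u-j≢0 ∘ u-vanishes j))
...   | no  u≡0 = contradiction (rows-independent d (λ _ i∉⊤ → contradiction ∈⊤ i∉⊤) u-vanishes⊤ q) d-q≢0
  where
  u-vanishes⊤ : VanishesOn ⊤ (d ᵛ* N)
  u-vanishes⊤ j _ = decidable-stable ((d ᵛ* N) j ≟K 0K) (λ u-j≢0 → u≡0 (j , u-j≢0))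

rowBasis-size≡rank : {𝓜 : Matroid n} {M : Mat m n} {r : ℕ} →
                     HasRank 𝓜 r → Represents M 𝓜 → (B : RowBasis M) → RowBasis.size B ≡ r
rowBasis-size≡rank {𝓜 = 𝓜} {M} {r} ((A , A-independent , |A|≡r) , independent⇒≤r) rep B =
  ≤-antisym size≤r r≤size
  where
  open RowBasis B
  N : Mat size _
  N a = M (rows a)
  A-cols : ColsIndep N A
  A-cols = colsIndep-spanned {M = M} {N = N} spanning {S = A} (proj₁ (rep A) A-independent)
  r≤size : r ≤ size
  r≤size = subst (_≤ size) |A|≡r (independentCols≤rows {N = N} {S = A} A-cols)
  maximal : ∀ j → j ∉ A → ¬ ColsIndep N (A ∪ ⁅ j ⁆)
  maximal j j∉A A∪⁅j⁆-cols = <-irrefl |A|≡r (<-≤-trans |A|<|A∪⁅j⁆| |A∪⁅j⁆|≤r)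
    where
    |A|<|A∪⁅j⁆| : ∣ A ∣ < ∣ A ∪ ⁅ j ⁆ ∣
    |A|<|A∪⁅j⁆| = p⊂q⇒∣p∣<∣q∣ (p⊆p∪q ⁅ j ⁆ , j , x∈p∪q⁺ (inj₂ (x∈⁅x⁆ j)) , j∉A)
    |A∪⁅j⁆|≤r : ∣ A ∪ ⁅ j ⁆ ∣ ≤ r
    |A∪⁅j⁆|≤r = independent⇒≤r (A ∪ ⁅ j ⁆)
      (proj₂ (rep (A ∪ ⁅ j ⁆)) (colsIndep-spanned {M = N} {N = M} (selection-spanned M rows) A∪⁅j⁆-cols))
  size≤r : size ≤ r
  size≤r = subst (size ≤_) |A|≡r (independentRows≤maximalCols {N = N} {A = A} independent A-cols maximal)

RowSelection : Matroid n → Mat m n → ℕ → Set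
RowSelection {m = m} 𝓜 M r =
  Σ (Fin r → Fin m) λ rows →
    StrictlyIncreasing rows ×
    Isℍmatrix (λ i j → M (rows i) j) ×
    Represents (λ i j → M (rows i) j) 𝓜 ×
    (∀ v → InΛ M v ⇔ InΛ (λ i j → M (rows i) j) v) ×
    (∀ v → InΛ* M v ⇔ InΛ* (λ i j → M (rows i) j) v) ×
    (∀ v → InΛ⊕Λ* M v ⇔ InΛ⊕Λ* (λ i j → M (rows i) j) v)

rowBasis-selection : {𝓜 : Matroid n} {M : Mat m n} →
                     Isℍmatrix M → Represents M 𝓜 → (B : RowBasis M) → RowSelection 𝓜 M (RowBasis.size B)
rowBasis-selection {𝓜 = 𝓜} {M = M} ℍ represents-𝓜 B =
  rows , increasing , Isℍmatrix-selection M rows increasing ℍ , represents {𝓜} represents-𝓜 ,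
  InΛ-⇔ , InΛ*-⇔ , InΛ⊕Λ*-⇔
  where
  open RowBasis B
  open RowEquivalence {M = M} {N = λ a → M (rows a)} spanning (selection-spanned M rows)

lemma3p4 : ∀ {m n r : ℕ} (𝓜 : Matroid n) (M : Mat m n) →
    HasRank 𝓜 r → Isℍmatrix M → Represents M 𝓜 →
    Σ (Fin r → Fin m) λ rows →
      StrictlyIncreasing rows ×
      Isℍmatrix (λ i j → M (rows i) j) ×
      Represents (λ i j → M (rows i) j) 𝓜 ×
      (∀ v → InΛ M v ⇔ InΛ (λ i j → M (rows i) j) v) ×
      (∀ v → InΛ* M v ⇔ InΛ* (λ i j → M (rows i) j) v) ×
      (∀ v → InΛ⊕Λ* M v ⇔ InΛ⊕Λ* (λ i j → M (rows i) j) v)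
lemma3p4 𝓜 M rank ℍ represents-𝓜 =
  subst (RowSelection 𝓜 M) (rowBasis-size≡rank {𝓜 = 𝓜} rank represents-𝓜 basis)
    (rowBasis-selection {𝓜 = 𝓜} ℍ represents-𝓜 basis)
  where
  basis : RowBasis M
  basis = rowBasis M
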